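{- If there exist a PS$(v)$ and an APS$(u,\alpha,\beta)$ with $u\equiv 7,11\pmod{12}$, then there exists an APS$(vu,v\alpha,v\beta)$.
   Context: PS$(v)$ ($v\equiv1\pmod4$): a set $\mathcal S$ of $(v-1)/4$ unordered pairs from $\mathbb{Z}_v$ with $\bigcup_{\{x,y\}\in\mathcal S}\pm\{x,y\}=\bigcup_{\{x,y\}\in\mathcal S}\pm\{x-y,x+y\}=\mathbb{Z}_v\setminus\{0\}$. APS$(n,\alpha,\beta)$ ($n\equiv3\pmod4$, $\alpha,\beta$ nonzero in $\mathbb{Z}_n$): a set $\mathcal S$ of $(n-3)/4$ unordered pairs from $\mathbb{Z}_n$ with $\bigcup\pm\{x,y\}=\mathbb{Z}_n\setminus\{0,\pm\alpha\}$ and $\bigcup\pm\{x-y,x+y\}=\mathbb{Z}_n\setminus\{0,\pm\beta\}$. For $\alpha\in\mathbb{Z}_u$, $v\alpha$ denotes the well-defined element of $\mathbb{Z}_{vu}$ obtained by multiplying a representative of $\alpha$ by $v$. -}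

module Defs where

open import Data.Nat using (ℕ; zero; suc; _+_; _*_; _∸_; _/_; _%_; NonZero)
open import Data.Nat.DivMod using (_mod_)
open import Data.Nat.Properties using (m*n≢0)
open import Data.Fin using (Fin; toℕ)
open import Data.Product using (Σ; _×_; _,_)
open import Data.Sum using (_⊎_)
open import Data.List using (List; length)
open import Data.List.Relation.Unary.Any using (Any)
open import Relation.Binary.PropositionalEquality using (_≡_; _≢_)
open import Relation.Nullary using (¬_)
open import Function.Bundles using (_⇔_)

-- ℤ_n is represented by Fin n (canonical residues 0..n-1), with modular operations.
module _ (n : ℕ) .{{_ : NonZero n}} where

  zeroₙ : Fin n
  zeroₙ = 0 mod n

  negₙ : Fin n → Fin n
  negₙ x = (n ∸ toℕ x) mod n

  addₙ : Fin n → Fin n → Fin n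
  addₙ x y = (toℕ x + toℕ y) mod n

  subₙ : Fin n → Fin n → Fin n
  subₙ x y = (toℕ x + (n ∸ toℕ y)) mod n

  -- An unordered pair {x,y} is represented by an ordered pair (x , y); all
  -- conditions below are symmetric in x and y, so the order is irrelevant.
  Pair : Set
  Pair = Fin n × Fin n

  InPm : Pair → Fin n → Set
  InPm (x , y) z = z ≡ x ⊎ z ≡ negₙ x ⊎ z ≡ y ⊎ z ≡ negₙ y

  InPmDiffSum : Pair → Fin n → Set
  InPmDiffSum (x , y) z = InPm (subₙ x y , addₙ x y) z

  InUnionPm : List Pair → Fin n → Set
  InUnionPm S z = Any (λ p → InPm p z) S

  InUnionPmDiffSum : List Pair → Fin n → Set
  InUnionPmDiffSum S z = Any (λ p → InPmDiffSum p z) S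

  IsPS : List Pair → Set
  IsPS S = (n % 4 ≡ 1)
         × (length S ≡ (n ∸ 1) / 4)
         × (∀ z → InUnionPm S z ⇔ (z ≢ zeroₙ))
         × (∀ z → InUnionPmDiffSum S z ⇔ (z ≢ zeroₙ))

  IsAPS : Fin n → Fin n → List Pair → Set
  IsAPS α β S = (n % 4 ≡ 3)
              × (α ≢ zeroₙ) × (β ≢ zeroₙ)
              × (length S ≡ (n ∸ 3) / 4)
              × (∀ z → InUnionPm S z ⇔ (z ≢ zeroₙ × z ≢ α × z ≢ negₙ α))
              × (∀ z → InUnionPmDiffSum S z ⇔ (z ≢ zeroₙ × z ≢ β × z ≢ negₙ β))

  PSExists : Set
  PSExists = Σ (List Pair) IsPS

  APSExists : Fin n → Fin n → Set
  APSExists α β = Σ (List Pair) (IsAPS α β)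

scaleInto : (v u : ℕ) .{{_ : NonZero v}} .{{_ : NonZero u}} → Fin u → Fin (v * u)
scaleInto v u α = _mod_ (v * toℕ α) (v * u) {{m*n≢0 v u}}

-- Let T be the APS(u, α, β) and S the PS(v).  The APS(vu, vα, vβ) consists of the pairs
-- (vx, vy) for {x, y} ∈ T, together with the u pairs (a + vi, b + 2vi), 0 ≤ i < u, for each
-- {a, b} ∈ S.  An element z = vt of ℤ_vu is hit by the scaled pairs exactly when t is hit by T,
-- which leaves out 0 and ±vα (resp. ±vβ).  An element z ≢ 0 (mod v) reduces to some w = ±c
-- with c ∈ {a, b} (resp. c ∈ {a - b, a + b}) for a pair {a, b} ∈ S, and the matching coordinate
-- of the block of {a, b} runs through c + kvi with k = 1, 2 (resp. k = -1, 3).  As u ≡ 7, 11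
-- (mod 12) is prime to 6, k is invertible mod u, so these u values are all the lifts of c to
-- ℤ_vu.  The sizes add up: (u - 3)/4 + u(v - 1)/4 = (vu - 3)/4.

module Submission where

-- Integer arithmetic is opened only inside this module: the statement at the end uses ℕ's _*_.
module _ where

  open import Defs
  open import Data.Nat as ℕ using (ℕ; NonZero; _%_; _/_)
  open import Data.Nat.Properties using (<⇒≤; m*n≢0)
  import Data.Nat.DivMod as DivMod
  open import Data.Nat.DivMod
    using (%-distribˡ-*; m*n/n≡m; m≡m%n+[m/n]*n; [m+kn]%n≡m%n; m<n⇒m%n≡m; m%n<n)
  open import Data.Fin using (Fin; toℕ; fromℕ<)
  open import Data.Fin.Properties using (toℕ-fromℕ<; toℕ-injective; toℕ<n; _≟_)
  open import Data.Integer as ℤ using (ℤ; +_; -[1+_]; 0ℤ; 1ℤ; _+_; _-_; -_; _*_)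
  open import Data.Integer.Properties
    using ( +-identityˡ; +-identityʳ; +-comm; *-comm; *-identityˡ; *-zeroʳ; *-distribˡ-+
          ; neg-distribˡ-*; neg-distribʳ-*; pos-+; pos-*; +-injective; neg-involutive; ⊖-≥; m-n≡m⊖n)
  open import Data.Integer.Divisibility.Signed
    using (_∣_; divides; ∣-refl; ∣-trans; ∣m⇒∣-m; ∣m∣n⇒∣m+n; ∣n⇒∣m*n; ∣m⇒∣m*n; *-monoʳ-∣; *-cancelˡ-∣)
  open import Data.Integer.DivMod using (_%ℕ_; _/ℕ_; a≡a%ℕn+[a/ℕn]*n; n%ℕd<d)
  open import Data.Integer.Tactic.RingSolver using (solve-∀)
  open import Data.Nat.Tactic.RingSolver using () renaming (solve-∀ to ℕ-solve-∀)
  open import Data.Product using (_×_; _,_; ∃-syntax; proj₁; proj₂; map₂)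
  open import Data.List using (List; []; _∷_; _++_; map; length; concatMap; applyUpTo)
  open import Data.List.Properties using (length-++; length-map; length-applyUpTo)
  open import Data.Sum using (_⊎_; inj₁; inj₂; [_,_]′)
  open import Data.List.Relation.Unary.Any as Any using (Any)
  open import Data.List.Relation.Unary.Any.Properties
    using (map⁺; map⁻; ++⁺ˡ; ++⁺ʳ; ++⁻; concatMap⁺; concatMap⁻; applyUpTo⁺; applyUpTo⁻)
  open import Data.List.Membership.Propositional using (find; lose)
  open import Relation.Nullary using (Dec; yes; no)
  open import Relation.Binary.PropositionalEquality
  open import Level using (0ℓ)
  open import Relation.Binary.Bundles using (Setoid)
  open import Relation.Binary.Structures using (IsEquivalence)
  import Relation.Binary.Reasoning.Setoid as SetoidReasoning
  open import Function using (_∘_)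
  open import Function.Bundles using (_⇔_; mk⇔; module Equivalence)
  open Equivalence using (to; from)

  -- Congruences of integers

  -- A record rather than the bare n ∣ a - b, so that a, b and n stay inferable.
  record _≡_mod_ (a b n : ℤ) : Set where
    constructor mod-∣
    field ∣-difference : n ∣ a - b

  infix 4 _≡_mod_

  private
    x-x≡0*n : ∀ x n → x - x ≡ 0ℤ * n
    x-x≡0*n = solve-∀
    -[x-y]≡y-x : ∀ x y → - (x - y) ≡ y - x
    -[x-y]≡y-x = solve-∀
    [x-y]+[y-z]≡x-z : ∀ x y z → (x - y) + (y - z) ≡ x - z
    [x-y]+[y-z]≡x-z = solve-∀
    [x-y]+[z-w]≡[x+z]-[y+w] : ∀ x y z w → (x - y) + (z - w) ≡ (x + z) - (y + w)
    [x-y]+[z-w]≡[x+z]-[y+w] = solve-∀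
    -[x-y]≡-x--y : ∀ x y → - (x - y) ≡ - x - - y
    -[x-y]≡-x--y = solve-∀
    c*[x-y]≡c*x-c*y : ∀ c x y → c * (x - y) ≡ c * x - c * y
    c*[x-y]≡c*x-c*y = solve-∀
    [x+y]-x≡y : ∀ x y → (x + y) - x ≡ y
    [x+y]-x≡y = solve-∀
    x≡y+[x-y] : ∀ x y → x ≡ y + (x - y)
    x≡y+[x-y] = solve-∀

  module _ {n : ℤ} where

    ≡⇒≡-mod : ∀ {a b} → a ≡ b → a ≡ b mod n
    ≡⇒≡-mod {a} refl = mod-∣ (divides 0ℤ (x-x≡0*n a n))

    mod-refl : ∀ {a} → a ≡ a mod n
    mod-refl = ≡⇒≡-mod refl

    mod-sym : ∀ {a b} → a ≡ b mod n → b ≡ a mod n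
    mod-sym {a} {b} (mod-∣ p) = mod-∣ (subst (n ∣_) (-[x-y]≡y-x a b) (∣m⇒∣-m p))

    mod-trans : ∀ {a b c} → a ≡ b mod n → b ≡ c mod n → a ≡ c mod n
    mod-trans {a} {b} {c} (mod-∣ p) (mod-∣ q) =
      mod-∣ (subst (n ∣_) ([x-y]+[y-z]≡x-z a b c) (∣m∣n⇒∣m+n p q))

    +-cong-mod : ∀ {a b c d} → a ≡ b mod n → c ≡ d mod n → a + c ≡ b + d mod n
    +-cong-mod {a} {b} {c} {d} (mod-∣ p) (mod-∣ q) =
      mod-∣ (subst (n ∣_) ([x-y]+[z-w]≡[x+z]-[y+w] a b c d) (∣m∣n⇒∣m+n p q))

    -‿cong-mod : ∀ {a b} → a ≡ b mod n → - a ≡ - b mod n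
    -‿cong-mod {a} {b} (mod-∣ p) = mod-∣ (subst (n ∣_) (-[x-y]≡-x--y a b) (∣m⇒∣-m p))

    *-congˡ-mod : ∀ c {a b} → a ≡ b mod n → c * a ≡ c * b mod n
    *-congˡ-mod c {a} {b} (mod-∣ p) = mod-∣ (subst (n ∣_) (c*[x-y]≡c*x-c*y c a b) (∣n⇒∣m*n c p))

    *-congʳ-mod : ∀ c {a b} → a ≡ b mod n → a * c ≡ b * c mod n
    *-congʳ-mod c {a} {b} p = subst₂ (_≡_mod n) (*-comm c a) (*-comm c b) (*-congˡ-mod c p)

    +-multiple-mod : ∀ a k → a + k * n ≡ a mod n
    +-multiple-mod a k = mod-∣ (divides k ([x+y]-x≡y a (k * n)))

    mod⇒≡+multiple : ∀ {a b} → a ≡ b mod n → ∃[ k ] a ≡ b + k * n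
    mod⇒≡+multiple {a} {b} (mod-∣ (divides k a-b≡k*n)) = k , trans (x≡y+[x-y] a b) (cong (_+_ b) a-b≡k*n)

    mod-isEquivalence : IsEquivalence (λ a b → a ≡ b mod n)
    mod-isEquivalence = record { refl = mod-refl ; sym = mod-sym ; trans = mod-trans }

  mod-setoid : ℤ → Setoid 0ℓ 0ℓ
  mod-setoid n = record { isEquivalence = mod-isEquivalence {n} }

  module ≡-mod-Reasoning (n : ℤ) = SetoidReasoning (mod-setoid n)

  *-scale-mod : ∀ v {u a b} → a ≡ b mod u → v * a ≡ v * b mod (v * u)
  *-scale-mod v {u} {a} {b} (mod-∣ p) = mod-∣ (subst (v * u ∣_) (c*[x-y]≡c*x-c*y v a b) (*-monoʳ-∣ v p))

  *-cancelˡ-mod : ∀ v {u a b} .{{_ : ℤ.NonZero v}} → v * a ≡ v * b mod (v * u) → a ≡ b mod u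
  *-cancelˡ-mod v {u} {a} {b} (mod-∣ p) = mod-∣ (*-cancelˡ-∣ v (subst (v * u ∣_) (sym (c*[x-y]≡c*x-c*y v a b)) p))

  mod-weaken : ∀ {v u a b} → a ≡ b mod (v * u) → a ≡ b mod v
  mod-weaken {u = u} (mod-∣ p) = mod-∣ (∣-trans (∣m⇒∣m*n u ∣-refl) p)

  %ℕ≡-mod : ∀ a n .{{_ : NonZero n}} → + (a %ℕ n) ≡ a mod + n
  %ℕ≡-mod a n = mod-sym (begin
    a                                ≡⟨ a≡a%ℕn+[a/ℕn]*n a n ⟩
    + (a %ℕ n) + (a /ℕ n) * + n      ≈⟨ +-multiple-mod (+ (a %ℕ n)) (a /ℕ n) ⟩
    + (a %ℕ n)                       ∎)
    where open ≡-mod-Reasoning (+ n)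

  -- ℤ_n as canonical residues

  ⟦_⟧ : ∀ {n} → Fin n → ℤ
  ⟦ x ⟧ = + toℕ x

  module _ (n : ℕ) .{{_ : NonZero n}} where

    private
      %-cong-by : ∀ x y k → + x ≡ + y + + k * + n → x % n ≡ y % n
      %-cong-by x y k x≡y+k*n = begin
        x % n                ≡⟨ cong (_% n) (+-injective (trans x≡y+k*n (sym +[y+k*n]≡+y+k*n))) ⟩
        (y ℕ.+ k ℕ.* n) % n  ≡⟨ [m+kn]%n≡m%n y k n ⟩
        y % n                ∎
        where
        open ≡-Reasoning
        +[y+k*n]≡+y+k*n : + (y ℕ.+ k ℕ.* n) ≡ + y + + k * + n
        +[y+k*n]≡+y+k*n = trans (pos-+ y _) (cong (_+_ (+ y)) (pos-* k n))

      %-cong-mod : ∀ x y → + x ≡ + y mod + n → x % n ≡ y % n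
      %-cong-mod x y (mod-∣ (divides (+ k) x-y≡k*n)) =
        %-cong-by x y k (trans (x≡y+[x-y] (+ x) (+ y)) (cong (_+_ (+ y)) x-y≡k*n))
      %-cong-mod x y (mod-∣ (divides -[1+ k ] x-y≡-[1+k]*n)) =
        sym (%-cong-by y x (ℕ.suc k) (trans (x≡y+[x-y] (+ y) (+ x)) (cong (_+_ (+ x)) y-x≡[1+k]*n)))
        where
        y-x≡[1+k]*n : + y - + x ≡ + ℕ.suc k * + n
        y-x≡[1+k]*n = trans (sym (-[x-y]≡y-x (+ x) (+ y))) (trans (cong -_ x-y≡-[1+k]*n) (neg-distribˡ-* -[1+ k ] (+ n)))

    ⟦⟧-injective-mod : ∀ {x y : Fin n} → ⟦ x ⟧ ≡ ⟦ y ⟧ mod + n → x ≡ y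
    ⟦⟧-injective-mod {x} {y} p = toℕ-injective (begin
      toℕ x     ≡⟨ m<n⇒m%n≡m (toℕ<n x) ⟨
      toℕ x % n ≡⟨ %-cong-mod (toℕ x) (toℕ y) p ⟩
      toℕ y % n ≡⟨ m<n⇒m%n≡m (toℕ<n y) ⟩
      toℕ y     ∎)
      where open ≡-Reasoning

    ⟦mod⟧ : ∀ m → ⟦ m DivMod.mod n ⟧ ≡ + m mod + n
    ⟦mod⟧ m = mod-sym (begin
      + m                                ≡⟨ cong +_ (m≡m%n+[m/n]*n m n) ⟩
      + (m % n ℕ.+ m / n ℕ.* n)          ≡⟨ trans (pos-+ (m % n) _) (cong (_+_ (+ (m % n))) (pos-* (m / n) n)) ⟩
      + (m % n) + + (m / n) * + n        ≈⟨ +-multiple-mod (+ (m % n)) (+ (m / n)) ⟩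
      + (m % n)                          ≡⟨ cong +_ (toℕ-fromℕ< (m%n<n m n)) ⟨
      ⟦ m DivMod.mod n ⟧                 ∎)
      where open ≡-mod-Reasoning (+ n)

    private
      n∸x≡n-x : ∀ (x : Fin n) → + (n ℕ.∸ toℕ x) ≡ + n - ⟦ x ⟧
      n∸x≡n-x x = trans (sym (⊖-≥ (<⇒≤ (toℕ<n x)))) (sym (m-n≡m⊖n n (toℕ x)))

      n+a≡a : ∀ a → + n + a ≡ a mod + n
      n+a≡a a = mod-trans (≡⇒≡-mod (trans (+-comm (+ n) a) (cong (_+_ a) (sym (*-identityˡ (+ n)))))) (+-multiple-mod a 1ℤ)

    ⟦zeroₙ⟧ : ⟦ zeroₙ n ⟧ ≡ 0ℤ mod + n
    ⟦zeroₙ⟧ = ⟦mod⟧ 0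

    ⟦addₙ⟧ : ∀ x y → ⟦ addₙ n x y ⟧ ≡ ⟦ x ⟧ + ⟦ y ⟧ mod + n
    ⟦addₙ⟧ x y = mod-trans (⟦mod⟧ _) (≡⇒≡-mod (pos-+ (toℕ x) (toℕ y)))

    ⟦negₙ⟧ : ∀ x → ⟦ negₙ n x ⟧ ≡ - ⟦ x ⟧ mod + n
    ⟦negₙ⟧ x = begin
      ⟦ negₙ n x ⟧          ≈⟨ ⟦mod⟧ _ ⟩
      + (n ℕ.∸ toℕ x)      ≡⟨ n∸x≡n-x x ⟩
      + n + - ⟦ x ⟧         ≈⟨ n+a≡a (- ⟦ x ⟧) ⟩
      - ⟦ x ⟧               ∎
      where open ≡-mod-Reasoning (+ n)

    ⟦subₙ⟧ : ∀ x y → ⟦ subₙ n x y ⟧ ≡ ⟦ x ⟧ - ⟦ y ⟧ mod + n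
    ⟦subₙ⟧ x y = begin
      ⟦ subₙ n x y ⟧                 ≈⟨ ⟦mod⟧ _ ⟩
      + (toℕ x ℕ.+ (n ℕ.∸ toℕ y))    ≡⟨ pos-+ (toℕ x) _ ⟩
      ⟦ x ⟧ + + (n ℕ.∸ toℕ y)        ≡⟨ cong (_+_ ⟦ x ⟧) (n∸x≡n-x y) ⟩
      ⟦ x ⟧ + (+ n - ⟦ y ⟧)          ≈⟨ +-cong-mod (mod-refl {a = ⟦ x ⟧}) (n+a≡a (- ⟦ y ⟧)) ⟩
      ⟦ x ⟧ - ⟦ y ⟧                  ∎
      where open ≡-mod-Reasoning (+ n)

    negₙ-involutive : ∀ x → negₙ n (negₙ n x) ≡ x
    negₙ-involutive x = ⟦⟧-injective-mod (begin
      ⟦ negₙ n (negₙ n x) ⟧  ≈⟨ ⟦negₙ⟧ (negₙ n x) ⟩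
      - ⟦ negₙ n x ⟧         ≈⟨ -‿cong-mod (⟦negₙ⟧ x) ⟩
      - - ⟦ x ⟧              ≡⟨ neg-involutive ⟦ x ⟧ ⟩
      ⟦ x ⟧                  ∎)
      where open ≡-mod-Reasoning (+ n)

  diffSum : (n : ℕ) .{{_ : NonZero n}} → Pair n → Pair n
  diffSum n (x , y) = subₙ n x y , addₙ n x y

  InUnionPmOf : (n : ℕ) .{{_ : NonZero n}} → (Pair n → Pair n) → List (Pair n) → Fin n → Set
  InUnionPmOf n Φ S z = Any (λ p → InPm n (Φ p) z) S

  Avoids : (n : ℕ) .{{_ : NonZero n}} → Fin n → Fin n → Set
  Avoids n γ z = z ≢ zeroₙ n × z ≢ γ × z ≢ negₙ n γ

  module PairTransfer {n m : ℕ} .{{_ : NonZero n}} .{{_ : NonZero m}}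
    (_∼_ : Fin n → Fin m → Set) (negₙ-∼ : ∀ {z t} → z ∼ t → negₙ n z ∼ negₙ m t) where

    _∼ᵖ_ : Pair n → Pair m → Set
    (x , y) ∼ᵖ (x′ , y′) = x ∼ x′ × y ∼ y′

    InPm-∼ : ∀ {p q z} → p ∼ᵖ q → InPm n p z → ∃[ t ] z ∼ t × InPm m q t
    InPm-∼ (x∼ , y∼) (inj₁ refl)               = _ , x∼ , inj₁ refl
    InPm-∼ (x∼ , y∼) (inj₂ (inj₁ refl))        = _ , negₙ-∼ x∼ , inj₂ (inj₁ refl)
    InPm-∼ (x∼ , y∼) (inj₂ (inj₂ (inj₁ refl))) = _ , y∼ , inj₂ (inj₂ (inj₁ refl))
    InPm-∼ (x∼ , y∼) (inj₂ (inj₂ (inj₂ refl))) = _ , negₙ-∼ y∼ , inj₂ (inj₂ (inj₂ refl))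

    InPm-∼⁻ : (∀ {z d t} → z ∼ t → d ∼ t → z ≡ d) →
              ∀ {p q z t} → p ∼ᵖ q → z ∼ t → InPm m q t → InPm n p z
    InPm-∼⁻ ∼-inj (x∼ , y∼) z∼ (inj₁ refl)               = inj₁ (∼-inj z∼ x∼)
    InPm-∼⁻ ∼-inj (x∼ , y∼) z∼ (inj₂ (inj₁ refl))        = inj₂ (inj₁ (∼-inj z∼ (negₙ-∼ x∼)))
    InPm-∼⁻ ∼-inj (x∼ , y∼) z∼ (inj₂ (inj₂ (inj₁ refl))) = inj₂ (inj₂ (inj₁ (∼-inj z∼ y∼)))
    InPm-∼⁻ ∼-inj (x∼ , y∼) z∼ (inj₂ (inj₂ (inj₂ refl))) = inj₂ (inj₂ (inj₂ (∼-inj z∼ (negₙ-∼ y∼))))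

  m%n≡r⇒m≡r+[m/n]*n : ∀ m n .{{_ : NonZero n}} {r} → m % n ≡ r → m ≡ r ℕ.+ (m / n) ℕ.* n
  m%n≡r⇒m≡r+[m/n]*n m n m%n≡r = trans (m≡m%n+[m/n]*n m n) (cong (ℕ._+ (m / n) ℕ.* n) m%n≡r)

  %4-product : ∀ v u → v % 4 ≡ 1 → u % 4 ≡ 3 → (v ℕ.* u) % 4 ≡ 3
  %4-product v u v%4≡1 u%4≡3 = trans (%-distribˡ-* v u 4) (cong₂ (λ a b → (a ℕ.* b) % 4) v%4≡1 u%4≡3)

  aps-size-product : ∀ v u → v % 4 ≡ 1 → u % 4 ≡ 3 →
                     (u ℕ.∸ 3) / 4 ℕ.+ ((v ℕ.∸ 1) / 4) ℕ.* u ≡ (v ℕ.* u ℕ.∸ 3) / 4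
  aps-size-product v u v%4≡1 u%4≡3 =
    aps-size-product′ (v / 4) (u / 4) (m%n≡r⇒m≡r+[m/n]*n v 4 v%4≡1) (m%n≡r⇒m≡r+[m/n]*n u 4 u%4≡3)
    where
    aps-size-product′ : ∀ p q {v u} → v ≡ 1 ℕ.+ p ℕ.* 4 → u ≡ 3 ℕ.+ q ℕ.* 4 →
                        (u ℕ.∸ 3) / 4 ℕ.+ ((v ℕ.∸ 1) / 4) ℕ.* u ≡ (v ℕ.* u ℕ.∸ 3) / 4
    aps-size-product′ p q refl refl = begin
      (q ℕ.* 4) / 4 ℕ.+ ((p ℕ.* 4) / 4) ℕ.* u′   ≡⟨ cong₂ (λ a b → a ℕ.+ b ℕ.* u′) (m*n/n≡m q 4) (m*n/n≡m p 4) ⟩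
      q ℕ.+ p ℕ.* u′                             ≡⟨ m*n/n≡m (q ℕ.+ p ℕ.* u′) 4 ⟨
      ((q ℕ.+ p ℕ.* u′) ℕ.* 4) / 4               ≡⟨ cong (_/ 4) (q*4+p*4*u≡[q+p*u]*4 p q) ⟨
      (q ℕ.* 4 ℕ.+ p ℕ.* 4 ℕ.* u′) / 4           ∎
      where
      open ≡-Reasoning
      u′ : ℕ
      u′ = 3 ℕ.+ q ℕ.* 4
      q*4+p*4*u≡[q+p*u]*4 : ∀ p q → q ℕ.* 4 ℕ.+ p ℕ.* 4 ℕ.* (3 ℕ.+ q ℕ.* 4) ≡ (q ℕ.+ p ℕ.* (3 ℕ.+ q ℕ.* 4)) ℕ.* 4
      q*4+p*4*u≡[q+p*u]*4 = ℕ-solve-∀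

  -- The product construction

  module Construction (v u : ℕ) .{{_ : NonZero v}} .{{_ : NonZero u}} where

    N : ℕ
    N = v ℕ.* u

    instance
      N≢0 : NonZero N
      N≢0 = m*n≢0 v u

    private
      mod-N⇒mod-v*u : ∀ {a b} → a ≡ b mod + N → a ≡ b mod (+ v * + u)
      mod-N⇒mod-v*u = subst (λ n → _ ≡ _ mod n) (pos-* v u)

    scale-mod : ∀ {a b} → a ≡ b mod + u → + v * a ≡ + v * b mod + N
    scale-mod p = subst (λ n → _ ≡ _ mod n) (sym (pos-* v u)) (*-scale-mod (+ v) p)

    cancel-mod : ∀ {a b} → + v * a ≡ + v * b mod + N → a ≡ b mod + u
    cancel-mod p = *-cancelˡ-mod (+ v) (mod-N⇒mod-v*u p)

    reduce-mod : ∀ {a b} → a ≡ b mod + N → a ≡ b mod + v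
    reduce-mod p = mod-weaken (mod-N⇒mod-v*u p)

    _≐v·_ : Fin N → Fin u → Set
    z ≐v· t = ⟦ z ⟧ ≡ + v * ⟦ t ⟧ mod + N

    scaleInto-≐ : ∀ t → scaleInto v u t ≐v· t
    scaleInto-≐ t = mod-trans (⟦mod⟧ N (v ℕ.* toℕ t)) (≡⇒≡-mod (pos-* v (toℕ t)))

    zeroₙ-≐ : zeroₙ N ≐v· zeroₙ u
    zeroₙ-≐ = begin
      ⟦ zeroₙ N ⟧           ≈⟨ ⟦zeroₙ⟧ N ⟩
      0ℤ                    ≡⟨ *-zeroʳ (+ v) ⟨
      + v * 0ℤ              ≈⟨ scale-mod (⟦zeroₙ⟧ u) ⟨
      + v * ⟦ zeroₙ u ⟧     ∎
      where open ≡-mod-Reasoning (+ N)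

    negₙ-≐ : ∀ {z t} → z ≐v· t → negₙ N z ≐v· negₙ u t
    negₙ-≐ {z} {t} z≐t = begin
      ⟦ negₙ N z ⟧          ≈⟨ ⟦negₙ⟧ N z ⟩
      - ⟦ z ⟧               ≈⟨ -‿cong-mod z≐t ⟩
      - (+ v * ⟦ t ⟧)       ≡⟨ neg-distribʳ-* (+ v) ⟦ t ⟧ ⟩
      + v * - ⟦ t ⟧         ≈⟨ scale-mod (⟦negₙ⟧ u t) ⟨
      + v * ⟦ negₙ u t ⟧    ∎
      where open ≡-mod-Reasoning (+ N)

    addₙ-≐ : ∀ {x y x′ y′} → x ≐v· x′ → y ≐v· y′ → addₙ N x y ≐v· addₙ u x′ y′
    addₙ-≐ {x} {y} {x′} {y′} x≐ y≐ = begin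
      ⟦ addₙ N x y ⟧              ≈⟨ ⟦addₙ⟧ N x y ⟩
      ⟦ x ⟧ + ⟦ y ⟧               ≈⟨ +-cong-mod x≐ y≐ ⟩
      + v * ⟦ x′ ⟧ + + v * ⟦ y′ ⟧ ≡⟨ *-distribˡ-+ (+ v) ⟦ x′ ⟧ ⟦ y′ ⟧ ⟨
      + v * (⟦ x′ ⟧ + ⟦ y′ ⟧)     ≈⟨ scale-mod (⟦addₙ⟧ u x′ y′) ⟨
      + v * ⟦ addₙ u x′ y′ ⟧      ∎
      where open ≡-mod-Reasoning (+ N)

    subₙ-≐ : ∀ {x y x′ y′} → x ≐v· x′ → y ≐v· y′ → subₙ N x y ≐v· subₙ u x′ y′
    subₙ-≐ {x} {y} {x′} {y′} x≐ y≐ = begin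
      ⟦ subₙ N x y ⟧                ≈⟨ ⟦subₙ⟧ N x y ⟩
      ⟦ x ⟧ - ⟦ y ⟧                 ≈⟨ +-cong-mod x≐ (-‿cong-mod y≐) ⟩
      + v * ⟦ x′ ⟧ - + v * ⟦ y′ ⟧   ≡⟨ c*[x-y]≡c*x-c*y (+ v) ⟦ x′ ⟧ ⟦ y′ ⟧ ⟨
      + v * (⟦ x′ ⟧ - ⟦ y′ ⟧)       ≈⟨ scale-mod (⟦subₙ⟧ u x′ y′) ⟨
      + v * ⟦ subₙ u x′ y′ ⟧        ∎
      where open ≡-mod-Reasoning (+ N)

    ≐-injective : ∀ {z d t c} → z ≐v· t → d ≐v· c → t ≡ c → z ≡ d
    ≐-injective z≐t d≐c refl = ⟦⟧-injective-mod N (mod-trans z≐t (mod-sym d≐c))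

    ≐-cancel : ∀ {z d t c} → z ≐v· t → d ≐v· c → z ≡ d → t ≡ c
    ≐-cancel z≐t d≐c refl = ⟦⟧-injective-mod u (cancel-mod (mod-trans (mod-sym z≐t) d≐c))

    avoids-≐ : ∀ γ {z t} → z ≐v· t → Avoids N (scaleInto v u γ) z ⇔ Avoids u γ t
    avoids-≐ γ z≐t = mk⇔
      (λ (z≢0 , z≢γ , z≢-γ) → z≢0 ∘ ≐-injective z≐t zeroₙ-≐
                            , z≢γ ∘ ≐-injective z≐t (scaleInto-≐ γ)
                            , z≢-γ ∘ ≐-injective z≐t (negₙ-≐ (scaleInto-≐ γ)))
      (λ (t≢0 , t≢γ , t≢-γ) → t≢0 ∘ ≐-cancel z≐t zeroₙ-≐
                            , t≢γ ∘ ≐-cancel z≐t (scaleInto-≐ γ)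
                            , t≢-γ ∘ ≐-cancel z≐t (negₙ-≐ (scaleInto-≐ γ)))

    ≡0-mod-v⇒≐ : ∀ {z} → ⟦ z ⟧ ≡ 0ℤ mod + v → ∃[ t ] z ≐v· t
    ≡0-mod-v⇒≐ {z} z≡0 with m , z≡0+m*v ← mod⇒≡+multiple z≡0 = t , (begin
      ⟦ z ⟧            ≡⟨ z≡0+m*v ⟩
      0ℤ + m * + v     ≡⟨ 0+x*y≡y*x m (+ v) ⟩
      + v * m          ≈⟨ scale-mod ⟦t⟧≡m ⟨
      + v * ⟦ t ⟧      ∎)
      where
      open ≡-mod-Reasoning (+ N)
      0+x*y≡y*x : ∀ x y → 0ℤ + x * y ≡ y * x
      0+x*y≡y*x = solve-∀
      t : Fin u
      t = fromℕ< (n%ℕd<d m u)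
      ⟦t⟧≡m : ⟦ t ⟧ ≡ m mod + u
      ⟦t⟧≡m = mod-trans (≡⇒≡-mod (cong +_ (toℕ-fromℕ< (n%ℕd<d m u)))) (%ℕ≡-mod m u)

    _≡ᵥ_ : Fin N → Fin v → Set
    z ≡ᵥ w = ⟦ z ⟧ ≡ ⟦ w ⟧ mod + v

    negₙ-≡ᵥ : ∀ {z w} → z ≡ᵥ w → negₙ N z ≡ᵥ negₙ v w
    negₙ-≡ᵥ {z} {w} z≡w = begin
      ⟦ negₙ N z ⟧   ≈⟨ reduce-mod (⟦negₙ⟧ N z) ⟩
      - ⟦ z ⟧        ≈⟨ -‿cong-mod z≡w ⟩
      - ⟦ w ⟧        ≈⟨ ⟦negₙ⟧ v w ⟨
      ⟦ negₙ v w ⟧   ∎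
      where open ≡-mod-Reasoning (+ v)

    ≡ᵥ-≢-≐ : ∀ {z w d c} → z ≡ᵥ w → w ≢ zeroₙ v → d ≐v· c → z ≢ d
    ≡ᵥ-≢-≐ {z} {w} {d} {c} z≡w w≢0 d≐c refl = w≢0 (⟦⟧-injective-mod v (begin
      ⟦ w ⟧           ≈⟨ z≡w ⟨
      ⟦ d ⟧           ≈⟨ reduce-mod d≐c ⟩
      + v * ⟦ c ⟧     ≡⟨ *-comm (+ v) ⟦ c ⟧ ⟩
      ⟦ c ⟧ * + v     ≡⟨ +-identityˡ (⟦ c ⟧ * + v) ⟨
      0ℤ + ⟦ c ⟧ * + v ≈⟨ +-multiple-mod 0ℤ ⟦ c ⟧ ⟩
      0ℤ              ≈⟨ ⟦zeroₙ⟧ v ⟨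
      ⟦ zeroₙ v ⟧     ∎))
      where open ≡-mod-Reasoning (+ v)

    ≡ᵥ-avoids : ∀ γ {z w} → z ≡ᵥ w → w ≢ zeroₙ v → Avoids N (scaleInto v u γ) z
    ≡ᵥ-avoids γ z≡w w≢0 = ≡ᵥ-≢-≐ z≡w w≢0 zeroₙ-≐
                         , ≡ᵥ-≢-≐ z≡w w≢0 (scaleInto-≐ γ)
                         , ≡ᵥ-≢-≐ z≡w w≢0 (negₙ-≐ (scaleInto-≐ γ))

    Invertible : ℤ → Set
    Invertible k = ∃[ h ] k * h ≡ 1ℤ mod + u

    private
      u≡r+q*12 : ∀ {r} → u % 12 ≡ r → + u ≡ + r + + (u / 12) * + 12
      u≡r+q*12 {r} u%12≡r =
        trans (cong +_ (m%n≡r⇒m≡r+[m/n]*n u 12 u%12≡r)) (trans (pos-+ r _) (cong (_+_ (+ r)) (pos-* (u / 12) 12)))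

    -- For u = 12q + 7: 2·(-(6q + 3)) = 3·(-(4q + 2)) = 1 - u.  For u = 12q + 11: 2·(6q + 6) = 3·(4q + 4) = 1 + u.
    invertible-2-3 : u % 12 ≡ 7 ⊎ u % 12 ≡ 11 → Invertible (+ 2) × Invertible (+ 3)
    invertible-2-3 (inj₁ u%12≡7) =
      witness {+ 2} (- (+ 3 + q * + 6)) (2*h-1 q) , witness {+ 3} (- (+ 2 + q * + 4)) (3*h-1 q)
      where
      q : ℤ
      q = + (u / 12)
      witness : ∀ {k} h → k * h - 1ℤ ≡ - 1ℤ * (+ 7 + q * + 12) → Invertible k
      witness h e = h , mod-∣ (divides (- 1ℤ) (trans e (cong (_*_ (- 1ℤ)) (sym (u≡r+q*12 u%12≡7)))))
      2*h-1 : ∀ q → + 2 * - (+ 3 + q * + 6) - 1ℤ ≡ - 1ℤ * (+ 7 + q * + 12)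
      2*h-1 = solve-∀
      3*h-1 : ∀ q → + 3 * - (+ 2 + q * + 4) - 1ℤ ≡ - 1ℤ * (+ 7 + q * + 12)
      3*h-1 = solve-∀
    invertible-2-3 (inj₂ u%12≡11) =
      witness {+ 2} (+ 6 + q * + 6) (2*h-1 q) , witness {+ 3} (+ 4 + q * + 4) (3*h-1 q)
      where
      q : ℤ
      q = + (u / 12)
      witness : ∀ {k} h → k * h - 1ℤ ≡ 1ℤ * (+ 11 + q * + 12) → Invertible k
      witness h e = h , mod-∣ (divides 1ℤ (trans e (cong (_*_ 1ℤ) (sym (u≡r+q*12 u%12≡11)))))
      2*h-1 : ∀ q → + 2 * (+ 6 + q * + 6) - 1ℤ ≡ 1ℤ * (+ 11 + q * + 12)
      2*h-1 = solve-∀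
      3*h-1 : ∀ q → + 3 * (+ 4 + q * + 4) - 1ℤ ≡ 1ℤ * (+ 11 + q * + 12)
      3*h-1 = solve-∀

    IsProgression : (ℕ → Fin N) → ℤ → ℤ → Set
    IsProgression f c k = ∀ i → ⟦ f i ⟧ ≡ c + k * (+ v * + i) mod + N

    record Progression (f : ℕ → Fin N) (w : Fin v) : Set where
      constructor progression
      field
        base step       : ℤ
        base≡           : ⟦ w ⟧ ≡ base mod + v
        step-invertible : Invertible step
        isProgression   : IsProgression f base step

    private
      x*[y*z]≡[x*z]*y : ∀ x y z → x * (y * z) ≡ (x * z) * y
      x*[y*z]≡[x*z]*y = solve-∀

    progression-≡ᵥ : ∀ {f w} → Progression f w → ∀ i → f i ≡ᵥ w
    progression-≡ᵥ {f} {w} (progression c k c≡w _ f≡) i = begin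
      ⟦ f i ⟧                ≈⟨ reduce-mod (f≡ i) ⟩
      c + k * (+ v * + i)    ≡⟨ cong (_+_ c) (x*[y*z]≡[x*z]*y k (+ v) (+ i)) ⟩
      c + (k * + i) * + v    ≈⟨ +-multiple-mod c (k * + i) ⟩
      c                      ≈⟨ c≡w ⟨
      ⟦ w ⟧                  ∎
      where open ≡-mod-Reasoning (+ v)

    progression-covers : ∀ {f w z} → Progression f w → z ≡ᵥ w → ∃[ i ] i ℕ.< u × z ≡ f i
    progression-covers {f} {w} {z} (progression c k c≡w (h , k*h≡1) f≡) z≡w
      with m , z≡c+m*v ← mod⇒≡+multiple (mod-trans z≡w c≡w) =
      i , n%ℕd<d (h * m) u , ⟦⟧-injective-mod N (begin
        ⟦ z ⟧                       ≡⟨ z≡c+m*v ⟩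
        c + m * + v                 ≡⟨ cong (_+_ c) (*-comm m (+ v)) ⟩
        c + + v * m                 ≈⟨ +-cong-mod (mod-refl {a = c}) (scale-mod k*h*m≡m) ⟨
        c + + v * (k * h * m)       ≡⟨ cong (_+_ c) (x*[[y*z]*w]≡y*[x*[z*w]] (+ v) k h m) ⟩
        c + k * (+ v * (h * m))     ≈⟨ +-cong-mod (mod-refl {a = c}) (*-congˡ-mod k (scale-mod (%ℕ≡-mod (h * m) u))) ⟨
        c + k * (+ v * + i)         ≈⟨ f≡ i ⟨
        ⟦ f i ⟧                     ∎)
      where
      open ≡-mod-Reasoning (+ N)
      i : ℕ
      i = (h * m) %ℕ u
      x*[[y*z]*w]≡y*[x*[z*w]] : ∀ x y z w → x * (y * z * w) ≡ y * (x * (z * w))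
      x*[[y*z]*w]≡y*[x*[z*w]] = solve-∀
      k*h*m≡m : k * h * m ≡ m mod + u
      k*h*m≡m = mod-trans (*-congʳ-mod m k*h≡1) (≡⇒≡-mod (*-identityˡ m))

    progression-covers-negₙ : ∀ {f w z} → Progression f w → z ≡ᵥ negₙ v w →
                              ∃[ i ] i ℕ.< u × z ≡ negₙ N (f i)
    progression-covers-negₙ {w = w} {z} P z≡-w =
      let i , i<u , -z≡fi = progression-covers P (subst (negₙ N z ≡ᵥ_) (negₙ-involutive v w) (negₙ-≡ᵥ z≡-w))
      in i , i<u , trans (sym (negₙ-involutive N z)) (cong (negₙ N) -z≡fi)

    IsProgression-subₙ : ∀ {f g c d k l} → IsProgression f c k → IsProgression g d l →
                         IsProgression (λ i → subₙ N (f i) (g i)) (c - d) (k - l)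
    IsProgression-subₙ {f} {g} {c} {d} {k} {l} f≡ g≡ i = begin
      ⟦ subₙ N (f i) (g i) ⟧            ≈⟨ ⟦subₙ⟧ N (f i) (g i) ⟩
      ⟦ f i ⟧ - ⟦ g i ⟧                 ≈⟨ +-cong-mod (f≡ i) (-‿cong-mod (g≡ i)) ⟩
      (c + k * x) - (d + l * x)         ≡⟨ [a+k*x]-[b+l*x] c d k l x ⟩
      (c - d) + (k - l) * x             ∎
      where
      open ≡-mod-Reasoning (+ N)
      x : ℤ
      x = + v * + i
      [a+k*x]-[b+l*x] : ∀ a b k l x → (a + k * x) - (b + l * x) ≡ (a - b) + (k - l) * x
      [a+k*x]-[b+l*x] = solve-∀

    IsProgression-addₙ : ∀ {f g c d k l} → IsProgression f c k → IsProgression g d l →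
                         IsProgression (λ i → addₙ N (f i) (g i)) (c + d) (k + l)
    IsProgression-addₙ {f} {g} {c} {d} {k} {l} f≡ g≡ i = begin
      ⟦ addₙ N (f i) (g i) ⟧            ≈⟨ ⟦addₙ⟧ N (f i) (g i) ⟩
      ⟦ f i ⟧ + ⟦ g i ⟧                 ≈⟨ +-cong-mod (f≡ i) (g≡ i) ⟩
      (c + k * x) + (d + l * x)         ≡⟨ [a+k*x]+[b+l*x] c d k l x ⟩
      (c + d) + (k + l) * x             ∎
      where
      open ≡-mod-Reasoning (+ N)
      x : ℤ
      x = + v * + i
      [a+k*x]+[b+l*x] : ∀ a b k l x → (a + k * x) + (b + l * x) ≡ (a + b) + (k + l) * x
      [a+k*x]+[b+l*x] = solve-∀

    progressionTerm : ℕ → ℕ → ℕ → Fin N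
    progressionTerm c k i = (c ℕ.+ k ℕ.* (v ℕ.* i)) DivMod.mod N

    progressionTerm-isProgression : ∀ c k → IsProgression (progressionTerm c k) (+ c) (+ k)
    progressionTerm-isProgression c k i = begin
      ⟦ progressionTerm c k i ⟧        ≈⟨ ⟦mod⟧ N _ ⟩
      + (c ℕ.+ k ℕ.* (v ℕ.* i))        ≡⟨ pos-+ c _ ⟩
      + c + + (k ℕ.* (v ℕ.* i))        ≡⟨ cong (_+_ (+ c)) (trans (pos-* k _) (cong (_*_ (+ k)) (pos-* v i))) ⟩
      + c + + k * (+ v * + i)          ∎
      where open ≡-mod-Reasoning (+ N)

    blockPair : Pair v → ℕ → Pair N
    blockPair (a , b) i = progressionTerm (toℕ a) 1 i , progressionTerm (toℕ b) 2 i

    blocks : List (Pair v) → List (Pair N)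
    blocks = concatMap (λ p → applyUpTo (blockPair p) u)

    length-blocks : ∀ S → length (blocks S) ≡ length S ℕ.* u
    length-blocks []      = refl
    length-blocks (p ∷ S) = trans (length-++ (applyUpTo (blockPair p) u))
                                  (cong₂ ℕ._+_ (length-applyUpTo (blockPair p) u) (length-blocks S))

    PairProgression : (ℕ → Pair N) → Pair v → Set
    PairProgression F (a , b) = Progression (proj₁ ∘ F) a × Progression (proj₂ ∘ F) b

    blockPair-progression : Invertible (+ 2) → ∀ p → PairProgression (blockPair p) p
    blockPair-progression 2-invertible (a , b) =
      progression ⟦ a ⟧ 1ℤ mod-refl (1ℤ , mod-refl) (progressionTerm-isProgression (toℕ a) 1) ,
      progression ⟦ b ⟧ (+ 2) mod-refl 2-invertible (progressionTerm-isProgression (toℕ b) 2)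

    diffSum-blockPair-progression : Invertible (+ 3) →
                                    ∀ p → PairProgression (diffSum N ∘ blockPair p) (diffSum v p)
    diffSum-blockPair-progression 3-invertible (a , b) =
      progression (⟦ a ⟧ - ⟦ b ⟧) (1ℤ - + 2) (⟦subₙ⟧ v a b) (- 1ℤ , mod-refl)
                  (IsProgression-subₙ {c = ⟦ a ⟧} {⟦ b ⟧} {1ℤ} {+ 2} a-prog b-prog) ,
      progression (⟦ a ⟧ + ⟦ b ⟧) (+ 3) (⟦addₙ⟧ v a b) 3-invertible
                  (IsProgression-addₙ {c = ⟦ a ⟧} {⟦ b ⟧} {1ℤ} {+ 2} a-prog b-prog)
      where
      a-prog : IsProgression (progressionTerm (toℕ a) 1) ⟦ a ⟧ 1ℤ
      a-prog = progressionTerm-isProgression (toℕ a) 1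
      b-prog : IsProgression (progressionTerm (toℕ b) 2) ⟦ b ⟧ (+ 2)
      b-prog = progressionTerm-isProgression (toℕ b) 2

    open PairTransfer _≡ᵥ_ negₙ-≡ᵥ using () renaming (InPm-∼ to InPm-≡ᵥ)

    InPm-progression-≡ᵥ : ∀ {F q z} → PairProgression F q → ∀ i → InPm N (F i) z →
                          ∃[ w ] z ≡ᵥ w × InPm v q w
    InPm-progression-≡ᵥ (P₁ , P₂) i = InPm-≡ᵥ (progression-≡ᵥ P₁ i , progression-≡ᵥ P₂ i)

    InPm-progression-covers : ∀ {F q z w} → PairProgression F q → z ≡ᵥ w → InPm v q w →
                              ∃[ i ] i ℕ.< u × InPm N (F i) z
    InPm-progression-covers (P₁ , P₂) z≡w (inj₁ refl) = map₂ (map₂ inj₁) (progression-covers P₁ z≡w)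
    InPm-progression-covers (P₁ , P₂) z≡w (inj₂ (inj₁ refl)) =
      map₂ (map₂ (inj₂ ∘ inj₁)) (progression-covers-negₙ P₁ z≡w)
    InPm-progression-covers (P₁ , P₂) z≡w (inj₂ (inj₂ (inj₁ refl))) =
      map₂ (map₂ (inj₂ ∘ inj₂ ∘ inj₁)) (progression-covers P₂ z≡w)
    InPm-progression-covers (P₁ , P₂) z≡w (inj₂ (inj₂ (inj₂ refl))) =
      map₂ (map₂ (inj₂ ∘ inj₂ ∘ inj₂)) (progression-covers-negₙ P₂ z≡w)

    residue-cases : ∀ z → (∃[ t ] z ≐v· t) ⊎ (∃[ w ] z ≡ᵥ w × w ≢ zeroₙ v)
    residue-cases z = split (mod-sym (⟦mod⟧ v (toℕ z))) (_ ≟ zeroₙ v)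
      where
      split : ∀ {w} → z ≡ᵥ w → Dec (w ≡ zeroₙ v) → (∃[ t ] z ≐v· t) ⊎ (∃[ w ] z ≡ᵥ w × w ≢ zeroₙ v)
      split z≡0 (yes refl) = inj₁ (≡0-mod-v⇒≐ (mod-trans z≡0 (⟦zeroₙ⟧ v)))
      split z≡w (no w≢0)   = inj₂ (_ , z≡w , w≢0)

    scalePair : Pair u → Pair N
    scalePair (x , y) = scaleInto v u x , scaleInto v u y

    open PairTransfer _≐v·_ negₙ-≐ using ()
      renaming (_∼ᵖ_ to _≐ᵖ_; InPm-∼ to InPm-≐; InPm-∼⁻ to InPm-≐⁻)

    scalePair-≐ : ∀ p → scalePair p ≐ᵖ p
    scalePair-≐ (x , y) = scaleInto-≐ x , scaleInto-≐ y

    diffSum-scalePair-≐ : ∀ p → diffSum N (scalePair p) ≐ᵖ diffSum u p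
    diffSum-scalePair-≐ (x , y) =
      subₙ-≐ (scaleInto-≐ x) (scaleInto-≐ y) , addₙ-≐ (scaleInto-≐ x) (scaleInto-≐ y)

    apsProduct : List (Pair u) → List (Pair v) → List (Pair N)
    apsProduct T S = map scalePair T ++ blocks S

    length-apsProduct : ∀ T S → length (apsProduct T S) ≡ length T ℕ.+ length S ℕ.* u
    length-apsProduct T S =
      trans (length-++ (map scalePair T)) (cong₂ ℕ._+_ (length-map scalePair T) (length-blocks S))

    module ProductUnion (Φᴺ : Pair N → Pair N) (Φᵘ : Pair u → Pair u) (Φᵛ : Pair v → Pair v)
      (Φ-scalePair-≐ : ∀ p → Φᴺ (scalePair p) ≐ᵖ Φᵘ p)
      (Φ-blockPair-progression : ∀ p → PairProgression (Φᴺ ∘ blockPair p) (Φᵛ p)) where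

      scaled⁻ : ∀ {T z} → InUnionPmOf N Φᴺ (map scalePair T) z → ∃[ t ] z ≐v· t × InUnionPmOf u Φᵘ T t
      scaled⁻ z∈ =
        let p , p∈T , z∈p = find (map⁻ z∈)
            t , z≐t , t∈p = InPm-≐ (Φ-scalePair-≐ p) z∈p
        in t , z≐t , lose p∈T t∈p

      scaled⁺ : ∀ {T z t} → z ≐v· t → InUnionPmOf u Φᵘ T t → InUnionPmOf N Φᴺ (map scalePair T) z
      scaled⁺ z≐t = map⁺ ∘ Any.map (InPm-≐⁻ (λ z≐ d≐ → ≐-injective z≐ d≐ refl) (Φ-scalePair-≐ _) z≐t)

      blocks⁻ : ∀ {S z} → InUnionPmOf N Φᴺ (blocks S) z → ∃[ w ] z ≡ᵥ w × InUnionPmOf v Φᵛ S w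
      blocks⁻ z∈ =
        let p , p∈S , z∈block = find (concatMap⁻ _ z∈)
            i , _ , z∈pᵢ      = applyUpTo⁻ (blockPair p) z∈block
            w , z≡w , w∈p     = InPm-progression-≡ᵥ (Φ-blockPair-progression p) i z∈pᵢ
        in w , z≡w , lose p∈S w∈p

      blocks⁺ : ∀ {S z w} → z ≡ᵥ w → InUnionPmOf v Φᵛ S w → InUnionPmOf N Φᴺ (blocks S) z
      blocks⁺ z≡w = concatMap⁺ _ ∘ Any.map λ {p} w∈p →
        let i , i<u , z∈pᵢ = InPm-progression-covers (Φ-blockPair-progression p) z≡w w∈p
        in applyUpTo⁺ (blockPair p) z∈pᵢ i<u

      union-⇔ : ∀ {T S γ} → (∀ t → InUnionPmOf u Φᵘ T t ⇔ Avoids u γ t) →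
                (∀ w → InUnionPmOf v Φᵛ S w ⇔ w ≢ zeroₙ v) →
                ∀ z → InUnionPmOf N Φᴺ (apsProduct T S) z ⇔ Avoids N (scaleInto v u γ) z
      union-⇔ {T} {S} {γ} T⇔ S⇔ z = mk⇔
        ([ (λ z∈ → let t , z≐t , t∈T = scaled⁻ z∈ in from (avoids-≐ γ z≐t) (to (T⇔ t) t∈T))
         , (λ z∈ → let w , z≡w , w∈S = blocks⁻ z∈ in ≡ᵥ-avoids γ z≡w (to (S⇔ w) w∈S))
         ]′ ∘ ++⁻ (map scalePair T))
        (λ z-avoids → [ (λ (t , z≐t) → ++⁺ˡ (scaled⁺ z≐t (from (T⇔ t) (to (avoids-≐ γ z≐t) z-avoids))))
                      , (λ (w , z≡w , w≢0) → ++⁺ʳ (map scalePair T) (blocks⁺ z≡w (from (S⇔ w) w≢0)))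
                      ]′ (residue-cases z))

open import Defs
open import Data.Nat using (ℕ; _*_; _%_; NonZero)
open import Data.Nat.Properties using (m*n≢0)
open import Data.Fin using (Fin)
open import Data.Sum using (_⊎_)
open import Relation.Binary.PropositionalEquality using (_≡_)
open import Data.Nat using (_+_)
open import Data.Product using (_,_; proj₁; proj₂)
open import Function using (_∘_; id)
open import Relation.Binary.PropositionalEquality using (trans; cong₂)

corollary4p3 : (v u : ℕ) .{{_ : NonZero v}} .{{_ : NonZero u}} (α β : Fin u)
    → PSExists v
    → APSExists u α β
    → (u % 12 ≡ 7 ⊎ u % 12 ≡ 11)
    → APSExists (v * u) {{m*n≢0 v u}} (scaleInto v u α) (scaleInto v u β)
corollary4p3 v u α β (S , v%4≡1 , |S| , S-pm , S-ds) (T , u%4≡3 , α≢0 , β≢0 , |T| , T-pm , T-ds) u%12 =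
  apsProduct T S ,
  %4-product v u v%4≡1 u%4≡3 ,
  α≢0 ∘ ≐-cancel (scaleInto-≐ α) zeroₙ-≐ ,
  β≢0 ∘ ≐-cancel (scaleInto-≐ β) zeroₙ-≐ ,
  trans (length-apsProduct T S)
        (trans (cong₂ (λ a b → a + b * u) |T| |S|) (aps-size-product v u v%4≡1 u%4≡3)) ,
  PmUnion.union-⇔ T-pm S-pm ,
  DiffSumUnion.union-⇔ T-ds S-ds
  where
  open Construction v u
  module PmUnion = ProductUnion id id id scalePair-≐ (blockPair-progression (proj₁ (invertible-2-3 u%12)))
  module DiffSumUnion = ProductUnion (diffSum N) (diffSum u) (diffSum v) diffSum-scalePair-≐
                                     (diffSum-blockPair-progression (proj₂ (invertible-2-3 u%12)))
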